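{- Let $\pi_1:\mathbb{Q}\langle e_0,e_1\rangle\to\mathbb{Q}e_0\oplus\mathbb{Q}e_1$ be the projection onto weight $1$, and $\Delta:\mathbb{Q}\langle e_0,e_1\rangle\to\mathbb{Q}\langle e_0,e_1\rangle\otimes\mathbb{Q}\langle e_0,e_1\rangle$ the algebra homomorphism with $\Delta(e_i)=e_i\otimes1+1\otimes e_i$. Then $\Delta_1:=(\pi_1\otimes\mathrm{id})\Delta$ satisfies, for every $n\ge1$, $$\Delta_1\mathcal B^n\subset\mathcal B^1\otimes\mathcal B^{n-1}.$$
   Context: $\mathbb{Q}\langle e_0,e_1\rangle$ is the free associative $\mathbb{Q}$-algebra on $e_0,e_1$; the weight of a word is its length. For a word $v=a_1\cdots a_N$ its block degree is $\deg_{\mathcal B}(v)=\#\{i:1\le i<N,\ a_i=a_{i+1}\}$. $\mathcal B^n=\mathcal B^n\mathbb{Q}\langle e_0,e_1\rangle$ is the span of words $w$ with $\deg_{\mathcal B}(e_0we_1)\ge n$ (with $\mathcal B^0=\mathbb{Q}\langle e_0,e_1\rangle$). -}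

module Defs where

open import Data.Bool using (Bool; true; false)
open import Data.Nat using (ℕ; zero; suc; _+_; _≤_)
open import Data.List using (List; []; _∷_; _++_; concatMap; foldr; filterᵇ)
open import Data.List.Properties using (≡-dec)
open import Data.List.Relation.Unary.All using (All)
open import Data.Rational using (ℚ; 0ℚ; 1ℚ) renaming (_+_ to _+ℚ_; _*_ to _*ℚ_)
open import Data.Product using (_×_; _,_; ∃-syntax)
open import Relation.Binary.PropositionalEquality using (_≡_; refl)
open import Relation.Nullary using (yes; no; Dec)
open import Relation.Binary.Definitions using (DecidableEquality)

data Letter : Set where
  e₀ e₁ : Letter

_≟L_ : DecidableEquality Letter
e₀ ≟L e₀ = yes refl
e₀ ≟L e₁ = no (λ ())
e₁ ≟L e₀ = no (λ ())
e₁ ≟L e₁ = yes refl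

-- Words (monomials of Q<e0,e1>); the weight of a word is its length.
Word : Set
Word = List Letter

_≟W_ : DecidableEquality Word
_≟W_ = ≡-dec _≟L_

sameL : Letter → Letter → ℕ
sameL a b with a ≟L b
... | yes _ = 1
... | no  _ = 0

blockDeg : Word → ℕ
blockDeg (a ∷ b ∷ w) = sameL a b + blockDeg (b ∷ w)
blockDeg _ = 0

degB' : Word → ℕ
degB' w = blockDeg (e₀ ∷ (w ++ (e₁ ∷ [])))

-- Elements of Q<e0,e1> : formal finite Q-linear combinations of words,
-- compared through their coefficient function (words form a basis).

NCPoly : Set
NCPoly = List (ℚ × Word)

coeff : NCPoly → Word → ℚ
coeff [] w = 0ℚ
coeff ((q , u) ∷ p) w with u ≟W w
... | yes _ = q +ℚ coeff p w
... | no  _ = coeff p w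

InB : ℕ → NCPoly → Set
InB n x = ∃[ L ] (All (λ { (q , w) → n ≤ degB' w }) L × (∀ w → coeff x w ≡ coeff L w))

-- Elements of Q<e0,e1> ⊗ Q<e0,e1> : formal Q-linear combinations of
-- u ⊗ v (u, v words), which form a basis of the tensor product.

Tens : Set
Tens = List (ℚ × Word × Word)

coeff₂ : Tens → Word → Word → ℚ
coeff₂ [] u v = 0ℚ
coeff₂ ((q , a , b) ∷ t) u v with a ≟W u | b ≟W v
... | yes _ | yes _ = q +ℚ coeff₂ t u v
... | _     | _     = coeff₂ t u v

_·T_ : Tens → Tens → Tens
s ·T t = concatMap (λ { (q , a , b) → concatMap (λ { (r , c , d) → (q *ℚ r , a ++ c , b ++ d) ∷ [] }) t }) s

oneT : Tens
oneT = (1ℚ , [] , []) ∷ []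

scaleT : ℚ → Tens → Tens
scaleT q t = concatMap (λ { (r , a , b) → (q *ℚ r , a , b) ∷ [] }) t

ΔLetter : Letter → Tens
ΔLetter a = (1ℚ , a ∷ [] , []) ∷ (1ℚ , [] , a ∷ []) ∷ []

ΔWord : Word → Tens
ΔWord w = foldr (λ a acc → ΔLetter a ·T acc) oneT w

Δ : NCPoly → Tens
Δ x = concatMap (λ { (q , w) → scaleT q (ΔWord w) }) x

isWeight1 : Word → Bool
isWeight1 (_ ∷ []) = true
isWeight1 _ = false

π₁⊗id : Tens → Tens
π₁⊗id t = filterᵇ (λ { (q , a , b) → isWeight1 a }) t

Δ₁ : NCPoly → Tens
Δ₁ x = π₁⊗id (Δ x)

InB⊗B : ℕ → ℕ → Tens → Set
InB⊗B m k T = ∃[ L ] (All (λ { (q , u , v) → (m ≤ degB' u) × (k ≤ degB' v) }) L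
                     × (∀ u v → coeff₂ T u v ≡ coeff₂ L u v))

module Submission where

-- Since Δ is multiplicative with Δ(a) = a ⊗ 1 + 1 ⊗ a, the part of Δ(a₁⋯a_N)
-- of left weight one is
--     Δ₁(a₁⋯a_N) = Σᵢ aᵢ ⊗ (a₁⋯âᵢ⋯a_N)        (a sum over letter deletions);
-- this is established first (Δ₁-word).  The two degree facts are then
-- elementary: deg_B(e₀ a e₁) = 1 for a letter a, and deleting one letter of w
-- lowers deg_B(e₀ w e₁) by at most one (deletion-degree).  Hence every term
-- of Δ₁ of a word of B^n lies in B¹ ⊗ B^{n-1}, and by linearity so does Δ₁ L
-- for any combination L of such words (Δ₁-bounds).
--
-- Elements are lists of terms, compared by their coefficients, so one also
-- needs that Δ₁ is well defined on coefficients.  Each coefficient of Δ₁ x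
-- is the value at x of a linear functional  x ↦ Σ q·f(w)  (coeff₂-Δ₁), and
-- such a value only depends on the coefficients of x: both sides can be
-- evaluated as a sum over a duplicate-free list of words containing the
-- supports (linExt-respects-coeff).

open import Defs
open import Data.Nat using (ℕ; _≤_; _∸_; suc)
import Data.Nat.Properties as ℕP
open import Data.List using (List; []; _∷_; [_]; _++_; map; concatMap; filterᵇ; deduplicate)
open import Data.List.Properties using (++-identityʳ; filter-++; concatMap-pure; concatMap-map; map-∘)
open import Data.List.Relation.Unary.All as All using (All; []; _∷_)
open import Data.List.Relation.Unary.All.Properties using (map⁺; ++⁺)
open import Data.List.Relation.Unary.Any using (here; there)
open import Data.List.Relation.Unary.Unique.Propositional using (Unique; _∷_)
open import Data.List.Relation.Unary.Unique.DecPropositional.Properties _≟W_ using (deduplicate-!)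
open import Data.List.Membership.Propositional using (_∈_)
open import Data.List.Membership.Propositional.Properties using (∈-map⁺; ∈-++⁺ˡ; ∈-++⁺ʳ; ∈-deduplicate⁺)
open import Data.Rational using (ℚ; 0ℚ; 1ℚ) renaming (_+_ to _+ℚ_; _*_ to _*ℚ_)
import Data.Rational.Properties as ℚP
open import Algebra.Bundles using (CommutativeMonoid)
open import Algebra.Properties.CommutativeSemigroup
  (CommutativeMonoid.commutativeSemigroup ℚP.+-0-commutativeMonoid) using (interchange)
open import Data.Bool using (Bool; true; false)
open import Data.Product using (_×_; _,_; proj₁; proj₂; map₂)
open import Relation.Binary.PropositionalEquality using (_≡_; _≢_; refl; sym; trans; cong; cong₂; subst; module ≡-Reasoning)
open import Relation.Nullary using (yes; no; contradiction)

Term : Set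
Term = ℚ × Word × Word

-- Multiplication of a term by c ⊗ 1, resp. by 1 ⊗ c, from the left.
leftMul rightMul : Letter → Term → Term
leftMul  c (r , a , b) = (1ℚ *ℚ r , c ∷ a , b)
rightMul c (r , a , b) = (1ℚ *ℚ r , a , c ∷ b)

concatMap-singleton : ∀ {A B : Set} (f : A → B) xs → concatMap (λ x → f x ∷ []) xs ≡ map f xs
concatMap-singleton f xs = trans (sym (concatMap-map [_] f xs)) (concatMap-pure (map f xs))

ΔLetter-· : ∀ c t → ΔLetter c ·T t ≡ map (leftMul c) t ++ (map (rightMul c) t ++ [])
ΔLetter-· c t =
  cong₂ _++_ (concatMap-singleton (leftMul c) t)
             (cong (_++ []) (concatMap-singleton (rightMul c) t))

isWeight0 : Term → Bool
isWeight0 (_ , [] , _)    = true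
isWeight0 (_ , _ ∷ _ , _) = false

weight0-leftMul : ∀ c t → filterᵇ isWeight0 (map (leftMul c) t) ≡ []
weight0-leftMul c []      = refl
weight0-leftMul c (_ ∷ t) = weight0-leftMul c t

weight0-rightMul : ∀ c t → filterᵇ isWeight0 (map (rightMul c) t) ≡ map (rightMul c) (filterᵇ isWeight0 t)
weight0-rightMul c []                    = refl
weight0-rightMul c ((r , [] , b) ∷ t)    = cong (_ ∷_) (weight0-rightMul c t)
weight0-rightMul c ((r , _ ∷ _ , b) ∷ t) = weight0-rightMul c t

π₁-leftMul : ∀ c t → π₁⊗id (map (leftMul c) t) ≡ map (leftMul c) (filterᵇ isWeight0 t)
π₁-leftMul c []                    = refl
π₁-leftMul c ((r , [] , b) ∷ t)    = cong (_ ∷_) (π₁-leftMul c t)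
π₁-leftMul c ((r , _ ∷ _ , b) ∷ t) = π₁-leftMul c t

π₁-rightMul : ∀ c t → π₁⊗id (map (rightMul c) t) ≡ map (rightMul c) (π₁⊗id t)
π₁-rightMul c []                        = refl
π₁-rightMul c ((r , [] , b) ∷ t)        = π₁-rightMul c t
π₁-rightMul c ((r , _ ∷ [] , b) ∷ t)    = cong (_ ∷_) (π₁-rightMul c t)
π₁-rightMul c ((r , _ ∷ _ ∷ _ , b) ∷ t) = π₁-rightMul c t

filter-ΔLetter : ∀ (p : Term → Bool) c t →
  filterᵇ p (ΔLetter c ·T t) ≡ filterᵇ p (map (leftMul c) t) ++ filterᵇ p (map (rightMul c) t)
filter-ΔLetter p c t = begin
    filterᵇ p (ΔLetter c ·T t)
  ≡⟨ cong (filterᵇ p) (ΔLetter-· c t) ⟩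
    filterᵇ p (map (leftMul c) t ++ (map (rightMul c) t ++ []))
  ≡⟨ filter-++ _ (map (leftMul c) t) _ ⟩
    filterᵇ p (map (leftMul c) t) ++ filterᵇ p (map (rightMul c) t ++ [])
  ≡⟨ cong (λ z → filterᵇ p (map (leftMul c) t) ++ filterᵇ p z) (++-identityʳ (map (rightMul c) t)) ⟩
    filterᵇ p (map (leftMul c) t) ++ filterᵇ p (map (rightMul c) t)
  ∎
  where open ≡-Reasoning

weight0-ΔWord : ∀ w → filterᵇ isWeight0 (ΔWord w) ≡ (1ℚ , [] , w) ∷ []
weight0-ΔWord []      = refl
weight0-ΔWord (c ∷ w) = begin
    filterᵇ isWeight0 (ΔLetter c ·T ΔWord w)
  ≡⟨ filter-ΔLetter isWeight0 c (ΔWord w) ⟩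
    filterᵇ isWeight0 (map (leftMul c) (ΔWord w)) ++ filterᵇ isWeight0 (map (rightMul c) (ΔWord w))
  ≡⟨ cong₂ _++_ (weight0-leftMul c (ΔWord w)) (weight0-rightMul c (ΔWord w)) ⟩
    map (rightMul c) (filterᵇ isWeight0 (ΔWord w))
  ≡⟨ cong (map (rightMul c)) (weight0-ΔWord w) ⟩
    (1ℚ , [] , c ∷ w) ∷ []
  ∎
  where open ≡-Reasoning

deletions : Word → List (Word × Word)
deletions []      = []
deletions (c ∷ w) = (c ∷ [] , w) ∷ map (map₂ (c ∷_)) (deletions w)

unitTerm : Word × Word → Term
unitTerm (a , b) = (1ℚ , a , b)

Δ₁word : Word → Tens
Δ₁word w = π₁⊗id (ΔWord w)

Δ₁-word : ∀ w → Δ₁word w ≡ map unitTerm (deletions w)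
Δ₁-word []      = refl
Δ₁-word (c ∷ w) = begin
    π₁⊗id (ΔLetter c ·T ΔWord w)
  ≡⟨ filter-ΔLetter _ c (ΔWord w) ⟩
    π₁⊗id (map (leftMul c) (ΔWord w)) ++ π₁⊗id (map (rightMul c) (ΔWord w))
  ≡⟨ cong₂ _++_ (π₁-leftMul c (ΔWord w)) (π₁-rightMul c (ΔWord w)) ⟩
    map (leftMul c) (filterᵇ isWeight0 (ΔWord w)) ++ map (rightMul c) (Δ₁word w)
  ≡⟨ cong₂ (λ z₁ z₂ → map (leftMul c) z₁ ++ map (rightMul c) z₂) (weight0-ΔWord w) (Δ₁-word w) ⟩
    (1ℚ , c ∷ [] , w) ∷ map (rightMul c) (map unitTerm (deletions w))
  ≡⟨ cong ((1ℚ , c ∷ [] , w) ∷_) (trans (sym (map-∘ (deletions w))) (map-∘ (deletions w))) ⟩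
    map unitTerm (deletions (c ∷ w))
  ∎
  where open ≡-Reasoning

π₁-scale : ∀ q t → π₁⊗id (scaleT q t) ≡ scaleT q (π₁⊗id t)
π₁-scale q []                        = refl
π₁-scale q ((r , [] , b) ∷ t)        = π₁-scale q t
π₁-scale q ((r , _ ∷ [] , b) ∷ t)    = cong (_ ∷_) (π₁-scale q t)
π₁-scale q ((r , _ ∷ _ ∷ _ , b) ∷ t) = π₁-scale q t

Δ₁-cons : ∀ q w x → Δ₁ ((q , w) ∷ x) ≡ scaleT q (Δ₁word w) ++ Δ₁ x
Δ₁-cons q w x =
  trans (filter-++ _ (scaleT q (ΔWord w)) (Δ x)) (cong (_++ Δ₁ x) (π₁-scale q (ΔWord w)))

coeff₂-++ : ∀ s t u v → coeff₂ (s ++ t) u v ≡ coeff₂ s u v +ℚ coeff₂ t u v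
coeff₂-++ [] t u v = sym (ℚP.+-identityˡ _)
coeff₂-++ ((q , a , b) ∷ s) t u v with a ≟W u | b ≟W v
... | yes _ | yes _ = trans (cong (q +ℚ_) (coeff₂-++ s t u v)) (sym (ℚP.+-assoc q _ _))
... | yes _ | no _  = coeff₂-++ s t u v
... | no _  | _     = coeff₂-++ s t u v

coeff₂-scale : ∀ q t u v → coeff₂ (scaleT q t) u v ≡ q *ℚ coeff₂ t u v
coeff₂-scale q [] u v = sym (ℚP.*-zeroʳ q)
coeff₂-scale q ((r , a , b) ∷ t) u v with a ≟W u | b ≟W v
... | yes _ | yes _ = trans (cong (q *ℚ r +ℚ_) (coeff₂-scale q t u v)) (sym (ℚP.*-distribˡ-+ q r _))
... | yes _ | no _  = coeff₂-scale q t u v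
... | no _  | _     = coeff₂-scale q t u v

linExt : (Word → ℚ) → NCPoly → ℚ
linExt f []            = 0ℚ
linExt f ((q , w) ∷ x) = q *ℚ f w +ℚ linExt f x

coeff₂-Δ₁ : ∀ x u v → coeff₂ (Δ₁ x) u v ≡ linExt (λ w → coeff₂ (Δ₁word w) u v) x
coeff₂-Δ₁ []            u v = refl
coeff₂-Δ₁ ((q , w) ∷ x) u v = begin
    coeff₂ (Δ₁ ((q , w) ∷ x)) u v
  ≡⟨ cong (λ z → coeff₂ z u v) (Δ₁-cons q w x) ⟩
    coeff₂ (scaleT q (Δ₁word w) ++ Δ₁ x) u v
  ≡⟨ coeff₂-++ (scaleT q (Δ₁word w)) (Δ₁ x) u v ⟩
    coeff₂ (scaleT q (Δ₁word w)) u v +ℚ coeff₂ (Δ₁ x) u v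
  ≡⟨ cong₂ _+ℚ_ (coeff₂-scale q (Δ₁word w) u v) (coeff₂-Δ₁ x u v) ⟩
    linExt (λ w → coeff₂ (Δ₁word w) u v) ((q , w) ∷ x)
  ∎
  where open ≡-Reasoning

sumOn : List Word → (Word → ℚ) → ℚ
sumOn []      g = 0ℚ
sumOn (s ∷ S) g = g s +ℚ sumOn S g

sumOn-cong : ∀ S {g h : Word → ℚ} → (∀ s → g s ≡ h s) → sumOn S g ≡ sumOn S h
sumOn-cong []      eq = refl
sumOn-cong (s ∷ S) eq = cong₂ _+ℚ_ (eq s) (sumOn-cong S eq)

sumOn-+ : ∀ S (g h : Word → ℚ) → sumOn S (λ s → g s +ℚ h s) ≡ sumOn S g +ℚ sumOn S h
sumOn-+ []      g h = refl
sumOn-+ (s ∷ S) g h =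
  trans (cong (g s +ℚ h s +ℚ_) (sumOn-+ S g h)) (interchange (g s) (h s) (sumOn S g) (sumOn S h))

sumOn-vanish : ∀ {S} {h : Word → ℚ} → All (λ s → h s ≡ 0ℚ) S → sumOn S h ≡ 0ℚ
sumOn-vanish []         = refl
sumOn-vanish (h0 ∷ hs0) = trans (cong₂ _+ℚ_ h0 (sumOn-vanish hs0)) (ℚP.+-identityˡ 0ℚ)

sumOn-point : ∀ {S w} (h : Word → ℚ) → Unique S → w ∈ S →
              (∀ s → s ≢ w → h s ≡ 0ℚ) → sumOn S h ≡ h w
sumOn-point h (w∉S ∷ _) (here refl) h0 =
  trans (cong (h _ +ℚ_) (sumOn-vanish (All.map (λ w≢s → h0 _ (λ s≡w → w≢s (sym s≡w))) w∉S)))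
        (ℚP.+-identityʳ _)
sumOn-point h (s∉S ∷ uS) (there w∈S) h0 =
  trans (cong₂ _+ℚ_ (h0 _ (All.lookup s∉S w∈S)) (sumOn-point h uS w∈S h0)) (ℚP.+-identityˡ _)

coeff-cons : ∀ q w x s → coeff ((q , w) ∷ x) s ≡ coeff ((q , w) ∷ []) s +ℚ coeff x s
coeff-cons q w x s with w ≟W s
... | yes _ = cong (_+ℚ coeff x s) (sym (ℚP.+-identityʳ q))
... | no _  = sym (ℚP.+-identityˡ (coeff x s))

coeff-single-self : ∀ q w → coeff ((q , w) ∷ []) w ≡ q
coeff-single-self q w with w ≟W w
... | yes _  = ℚP.+-identityʳ q
... | no w≢w = contradiction refl w≢w

coeff-single-other : ∀ q w s → s ≢ w → coeff ((q , w) ∷ []) s ≡ 0ℚ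
coeff-single-other q w s s≢w with w ≟W s
... | yes w≡s = contradiction (sym w≡s) s≢w
... | no _    = refl

linExt-on-support : ∀ {S} → Unique S → (f : Word → ℚ) (x : NCPoly) →
  All (λ t → proj₂ t ∈ S) x → linExt f x ≡ sumOn S (λ s → coeff x s *ℚ f s)
linExt-on-support {S} uS f [] [] =
  sym (sumOn-vanish (All.tabulate {xs = S} (λ {s} _ → ℚP.*-zeroˡ (f s))))
linExt-on-support {S} uS f ((q , w) ∷ x) (w∈S ∷ x⊆S) = begin
    q *ℚ f w +ℚ linExt f x
  ≡⟨ cong₂ _+ℚ_ (sym single) (linExt-on-support uS f x x⊆S) ⟩
    sumOn S (λ s → coeff ((q , w) ∷ []) s *ℚ f s) +ℚ sumOn S (λ s → coeff x s *ℚ f s)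
  ≡⟨ sym (sumOn-+ S _ _) ⟩
    sumOn S (λ s → coeff ((q , w) ∷ []) s *ℚ f s +ℚ coeff x s *ℚ f s)
  ≡⟨ sumOn-cong S (λ s → trans (sym (ℚP.*-distribʳ-+ (f s) (coeff ((q , w) ∷ []) s) (coeff x s))) (cong (_*ℚ f s) (sym (coeff-cons q w x s)))) ⟩
    sumOn S (λ s → coeff ((q , w) ∷ x) s *ℚ f s)
  ∎
  where
    open ≡-Reasoning
    single : sumOn S (λ s → coeff ((q , w) ∷ []) s *ℚ f s) ≡ q *ℚ f w
    single = trans (sumOn-point _ uS w∈S (λ s s≢w → trans (cong (_*ℚ f s) (coeff-single-other q w s s≢w)) (ℚP.*-zeroˡ (f s))))
                   (cong (_*ℚ f w) (coeff-single-self q w))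

linExt-respects-coeff : ∀ {x y} → (∀ w → coeff x w ≡ coeff y w) → ∀ f → linExt f x ≡ linExt f y
linExt-respects-coeff {x} {y} x≈y f = begin
    linExt f x
  ≡⟨ linExt-on-support uS f x (All.map (λ p → ∈-deduplicate⁺ _≟W_ (∈-++⁺ˡ p)) (words-in x)) ⟩
    sumOn S (λ s → coeff x s *ℚ f s)
  ≡⟨ sumOn-cong S (λ s → cong (_*ℚ f s) (x≈y s)) ⟩
    sumOn S (λ s → coeff y s *ℚ f s)
  ≡⟨ sym (linExt-on-support uS f y (All.map (λ p → ∈-deduplicate⁺ _≟W_ (∈-++⁺ʳ (map proj₂ x) p)) (words-in y))) ⟩
    linExt f y
  ∎
  where
    open ≡-Reasoning
    S = deduplicate _≟W_ (map proj₂ x ++ map proj₂ y)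
    uS : Unique S
    uS = deduplicate-! _
    words-in : ∀ z → All (λ t → proj₂ t ∈ map proj₂ z) z
    words-in z = All.tabulate (∈-map⁺ proj₂)

Δ₁-respects-coeff : ∀ x y → (∀ w → coeff x w ≡ coeff y w) →
                    ∀ u v → coeff₂ (Δ₁ x) u v ≡ coeff₂ (Δ₁ y) u v
Δ₁-respects-coeff x y x≈y u v =
  trans (coeff₂-Δ₁ x u v)
        (trans (linExt-respects-coeff {x} {y} x≈y (λ w → coeff₂ (Δ₁word w) u v))
               (sym (coeff₂-Δ₁ y u v)))

framedDeg : Letter → Word → ℕ
framedDeg p w = blockDeg (p ∷ w ++ e₁ ∷ [])

drop-middle : ∀ p c y r → blockDeg (p ∷ c ∷ y ∷ r) ≤ suc (blockDeg (p ∷ y ∷ r))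
drop-middle e₀ e₀ e₀ r = ℕP.≤-refl
drop-middle e₀ e₀ e₁ r = ℕP.≤-refl
drop-middle e₀ e₁ e₀ r = ℕP.m≤n+m _ 2
drop-middle e₀ e₁ e₁ r = ℕP.≤-refl
drop-middle e₁ e₀ e₀ r = ℕP.≤-refl
drop-middle e₁ e₀ e₁ r = ℕP.m≤n+m _ 2
drop-middle e₁ e₁ e₀ r = ℕP.≤-refl
drop-middle e₁ e₁ e₁ r = ℕP.≤-refl

drop-first : ∀ p c w → framedDeg p (c ∷ w) ≤ suc (framedDeg p w)
drop-first p c []      = drop-middle p c e₁ []
drop-first p c (y ∷ w) = drop-middle p c y (w ++ e₁ ∷ [])

deletion-degree : ∀ w p → All (λ ab → framedDeg p w ≤ suc (framedDeg p (proj₂ ab))) (deletions w)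
deletion-degree []      p = []
deletion-degree (c ∷ w) p = drop-first p c w ∷ map⁺ (All.map (λ {ab} → extend {ab}) (deletion-degree w c))
  where
    -- framedDeg p (c ∷ w) = [p = c] + framedDeg c w
    extend : ∀ {ab : Word × Word} → framedDeg c w ≤ suc (framedDeg c (proj₂ ab)) →
             framedDeg p (c ∷ w) ≤ suc (framedDeg p (c ∷ proj₂ ab))
    extend {_ , b} le =
      ℕP.≤-trans (ℕP.+-monoʳ-≤ (sameL p c) le) (ℕP.≤-reflexive (ℕP.+-suc (sameL p c) (framedDeg c b)))

letter-in-B¹ : ∀ a → 1 ≤ degB' (a ∷ [])
letter-in-B¹ e₀ = ℕP.≤-refl
letter-in-B¹ e₁ = ℕP.≤-refl

deletion-letter : ∀ w → All (λ ab → 1 ≤ degB' (proj₁ ab)) (deletions w)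
deletion-letter []      = []
deletion-letter (c ∷ w) = letter-in-B¹ c ∷ map⁺ (deletion-letter w)

Bounded : ℕ → ℕ → Word × Word → Set
Bounded m k (a , b) = (m ≤ degB' a) × (k ≤ degB' b)

deletion-bounds : ∀ {n} w → n ≤ degB' w → All (Bounded 1 (n ∸ 1)) (deletions w)
deletion-bounds {n} w n≤w =
  All.zipWith (λ (letter , deg) → letter , ℕP.∸-monoˡ-≤ 1 (ℕP.≤-trans n≤w deg))
              (deletion-letter w , deletion-degree w e₀)

scaleT-words : ∀ {P : Word × Word → Set} q t → All (λ t → P (proj₂ t)) t → All (λ t → P (proj₂ t)) (scaleT q t)
scaleT-words q []      []       = []
scaleT-words q (_ ∷ t) (p ∷ ps) = p ∷ scaleT-words q t ps

Δ₁-bounds : ∀ {n} (L : NCPoly) → All (λ t → n ≤ degB' (proj₂ t)) L →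
            All (λ t → Bounded 1 (n ∸ 1) (proj₂ t)) (Δ₁ L)
Δ₁-bounds []            []          = []
Δ₁-bounds {n} ((q , w) ∷ L) (n≤w ∷ L≥n) =
  subst (All _) (sym (Δ₁-cons q w L)) (++⁺ (scaleT-words q (Δ₁word w) word-bounds) (Δ₁-bounds L L≥n))
  where
    word-bounds : All (λ t → Bounded 1 (n ∸ 1) (proj₂ t)) (Δ₁word w)
    word-bounds = subst (All _) (sym (Δ₁-word w)) (map⁺ (deletion-bounds w n≤w))

-- The witness is Δ₁ L for the word combination L representing x.
theorem6p1 : (n : ℕ) → 1 ≤ n → (x : NCPoly) → InB n x → InB⊗B 1 (n ∸ 1) (Δ₁ x)
theorem6p1 n _ x (L , L∈Bⁿ , x≈L) = Δ₁ L , Δ₁-bounds L L∈Bⁿ , Δ₁-respects-coeff x L x≈L
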